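{- Let $q$ be a prime power and $n$ a positive integer. The number of maximal sets of rank $1$ of $\mathbb{S}_n(\mathbb{F}_q)$ is $\frac{q^n-1}{q-1}\,q^{\frac{n^2+n-2}{2}}$.
   Context: $\mathbb{S}_n(\mathbb{F}_q)$ denotes the set of $n\times n$ symmetric matrices over $\mathbb{F}_q$ (its elements are called points). Two points $S,S'$ are adjacent if $\operatorname{rank}(S-S')=1$. A subset $\mathcal{M}\subseteq\mathbb{S}_n(\mathbb{F}_q)$ is a maximal set of rank $1$ if any two distinct points of $\mathcal{M}$ are adjacent and no point of $\mathbb{S}_n(\mathbb{F}_q)\setminus\mathcal{M}$ is adjacent to every point of $\mathcal{M}$. -}

module Defs where

open import Level using (0ℓ)
open import Data.Nat using (ℕ; zero; suc)
open import Data.Fin using (Fin)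
open import Data.Vec using (Vec; lookup)
open import Data.Bool using (Bool; true; false)
open import Data.Product using (Σ; ∃; ∃-syntax; _×_; _,_)
open import Data.Nat using (_<_)
open import Relation.Nullary using (¬_)
open import Relation.Binary.PropositionalEquality using (_≡_; _≢_)
open import Algebra.Structures using (IsCommutativeRing)
open import Function.Bundles using (_↔_)

-- Every finite field has prime-power order q, and for every prime power q
-- there is such a field F_q; so quantifying over all FiniteField records
-- is the same as quantifying over prime powers q and the field F_q.
record FiniteField : Set₁ where
  field
    Carrier : Set
    _+_ _*_ : Carrier → Carrier → Carrier
    -_      : Carrier → Carrier
    0# 1#   : Carrier
    isCommutativeRing : IsCommutativeRing {A = Carrier} _≡_ _+_ _*_ -_ 0# 1#
    0≢1     : 0# ≢ 1#
    inverse : ∀ x → x ≢ 0# → ∃[ y ] (x * y ≡ 1#)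
    size    : ℕ
    enum    : Fin size ↔ Carrier

module _ (F : FiniteField) where
  open FiniteField F

  Mat : ℕ → Set
  Mat n = Vec (Vec Carrier n) n

  entry : ∀ {n} → Mat n → Fin n → Fin n → Carrier
  entry A i j = lookup (lookup A i) j

  sumF : ∀ r → (Fin r → Carrier) → Carrier
  sumF zero    f = 0#
  sumF (suc r) f = f Fin.zero + sumF r (λ k → f (Fin.suc k))

  _-ᴹ_ : ∀ {n} → Mat n → Mat n → (Fin n → Fin n → Carrier)
  (A -ᴹ B) i j = entry A i j + (- entry B i j)

  RankAtMost : ∀ {n} → ℕ → (Fin n → Fin n → Carrier) → Set
  RankAtMost {n} r D =
    Σ (Fin n → Fin r → Carrier) λ U → Σ (Fin r → Fin n → Carrier) λ V →
      ∀ i j → D i j ≡ sumF r (λ k → U i k * V k j)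

  Rank : ∀ {n} → (Fin n → Fin n → Carrier) → ℕ → Set
  Rank D r = RankAtMost r D × (∀ s → s < r → ¬ RankAtMost s D)

  Symmetric : ∀ {n} → Mat n → Set
  Symmetric A = ∀ i j → entry A i j ≡ entry A j i

  Subset : ℕ → Set
  Subset n = Mat n → Bool

  _≐_ : ∀ {n} → Subset n → Subset n → Set
  M ≐ M' = ∀ A → M A ≡ M' A

  Adjacent : ∀ {n} → Mat n → Mat n → Set
  Adjacent S S' = Rank (S -ᴹ S') 1

  MaximalRank1 : ∀ {n} → Subset n → Set
  MaximalRank1 M =
      (∀ A → M A ≡ true → Symmetric A)
    × (∀ A B → M A ≡ true → M B ≡ true → A ≢ B → Adjacent A B)
    × (∀ C → Symmetric C → M C ≡ false → ¬ (∀ A → M A ≡ true → Adjacent C A))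

  NumberOf : ∀ {n} → (Subset n → Set) → ℕ → Set
  NumberOf {n} P N =
    Σ (Fin N → Subset n) λ f →
        (∀ i → P (f i))
      × (∀ i j → f i ≐ f j → i ≡ j)
      × (∀ M → P M → ∃[ i ] (M ≐ f i))

-- A maximal set of rank 1 is a line {B + t·x xᵀ : t ∈ F} with B symmetric and x ≠ 0.  Two of its points
-- S ≠ T differ by a symmetric rank-one matrix c·x xᵀ, and for any further point A both A − S and
-- A − S − c·x xᵀ have rank at most 1; a computation with 2 × 2 minors then forces A − S to be a multiple of
-- x xᵀ.  The same computation shows that every line is maximal.  Normalising x (first nonzero entry 1) and
-- B (zero at the pivot of x) names each line exactly once, with (q^n − 1)/(q − 1) choices for x and
-- q^(n(n+1)/2 − 1) choices for B.

module Submission where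

open import Defs
open import Level using (0ℓ)
open import Algebra.Bundles using (CommutativeRing; RawRing)
open import Algebra.Solver.Ring.AlmostCommutativeRing
  using (fromCommutativeRing; _-Raw-AlmostCommutative⟶_)
import Algebra.Solver.Ring
import Algebra.Solver.Ring.NaturalCoefficients
import Algebra.Properties.Ring
import Algebra.Properties.Semiring.Mult.TCOptimised
import Relation.Binary.Reasoning.Setoid
open import Data.Bool as Bool using (true; false)
open import Data.Bool.Properties using (¬-not)
open import Data.Empty using (⊥; ⊥-elim)
open import Data.Fin using (Fin; zero; suc)
import Data.Fin.Properties as Fin
open import Data.Maybe using (Maybe; just; nothing)
open import Data.Nat as ℕ using (ℕ; zero; suc; z≤n; s≤s)
open import Data.Nat.DivMod using (m*n/n≡m)
open import Data.Nat.Properties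
  using (+-suc; *-zeroʳ; *-distribʳ-+; *-distribʳ-∸; ^-distribˡ-+-*; m+n∸n≡m)
open import Data.Nat.Solver using (module +-*-Solver)
open import Data.Product using (Σ; Σ-syntax; ∃; ∃-syntax; _×_; _,_; proj₁; proj₂; uncurry)
open import Data.Product.Function.Dependent.Propositional using (Σ-↔)
open import Data.Product.Function.NonDependent.Propositional using (_×-↔_)
open import Data.Product.Properties using (≡-dec)
open import Data.Sum using (_⊎_; inj₁; inj₂; [_,_]′; reduce)
open import Data.Sum.Function.Propositional using (_⊎-↔_)
open import Data.Unit using (⊤; tt)
open import Data.Vec using (Vec; []; _∷_; lookup; tabulate; uncons)
open import Data.Vec.Properties using (lookup∘tabulate; tabulate∘lookup; tabulate-cong)
import Data.Vec.Properties as Vec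
open import Function using (_∘_; id; _↔_; mk↔ₛ′; mk⇔; Inverse)
open import Function.Properties.Inverse using (↔-sym; ↔-trans; ↔⇒↣)
open import Relation.Binary.Definitions using (DecidableEquality)
open import Relation.Binary.PropositionalEquality as ≡
  using (_≡_; _≢_; cong; cong₂; subst; module ≡-Reasoning)
open import Relation.Nullary using (Dec; yes; no; ¬_; does)
open import Relation.Nullary.Decidable using (via-injection; dec-true; _×-dec_; ¬?)
import Relation.Nullary.Decidable as Dec

module CommutativeRingSolver {c ℓ} (R : CommutativeRing c ℓ) where
  open CommutativeRing R hiding (zero)
  open Algebra.Properties.Ring ring
    using (-0#≈0#; -‿distribˡ-*; -‿distribʳ-*; -‿involutive; -‿+-comm; ⁻¹-anti-homo‿-)
  open Algebra.Properties.Semiring.Mult.TCOptimised semiring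
    renaming (_×_ to _·_) using (1+×; ×-homo-+; ×1-homo-*)
  open Algebra.Solver.Ring.NaturalCoefficients commutativeSemiring (λ _ _ → nothing)
    using (_:+_; _:*_; _:=_) renaming (solve to solve-semiring)
  open Relation.Binary.Reasoning.Setoid setoid

  private
    ι : ℕ → Carrier
    ι n = n · 1#

    -- A pair (a , b) denotes a − b.  `cancel` keeps pairs reduced (one component zero), so that a
    -- coefficient which vanishes over ℤ is literally (0 , 0) and the solver sees the cancellation.
    cancel : ℕ → ℕ → ℕ × ℕ
    cancel (suc a) (suc b) = cancel a b
    cancel a       b       = a , b

    Differences : RawRing 0ℓ 0ℓ
    Differences = record
      { Carrier = ℕ × ℕ
      ; _≈_     = _≡_
      ; _+_     = λ { (a , b) (c , d) → cancel (a ℕ.+ c) (b ℕ.+ d) }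
      ; _*_     = λ { (a , b) (c , d) → cancel (a ℕ.* c ℕ.+ b ℕ.* d) (a ℕ.* d ℕ.+ b ℕ.* c) }
      ; -_      = λ { (a , b) → b , a }
      ; 0#      = 0 , 0
      ; 1#      = 1 , 0
      }

    ⟦_⟧ : ℕ × ℕ → Carrier
    ⟦ a , zero  ⟧ = ι a
    ⟦ a , suc b ⟧ = ι a - ι (suc b)

    ⟦⟧-difference : ∀ a b → ⟦ a , b ⟧ ≈ ι a - ι b
    ⟦⟧-difference a zero    = sym (trans (+-congˡ -0#≈0#) (+-identityʳ (ι a)))
    ⟦⟧-difference a (suc b) = refl

    sub-+ : ∀ x y z w → (x + z) - (y + w) ≈ (x - y) + (z - w)
    sub-+ x y z w = begin
      (x + z) - (y + w)     ≈⟨ +-congˡ (-‿+-comm y w) ⟨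
      (x + z) + (- y + - w) ≈⟨ solve-semiring 4 (λ x z y w → (x :+ z) :+ (y :+ w) := (x :+ y) :+ (z :+ w))
                                 refl x z (- y) (- w) ⟩
      (x - y) + (z - w)     ∎

    sub-* : ∀ x y z w → (x * z + y * w) - (x * w + y * z) ≈ (x - y) * (z - w)
    sub-* x y z w = begin
      (x * z + y * w) - (x * w + y * z)         ≈⟨ +-congˡ (-‿+-comm (x * w) (y * z)) ⟨
      (x * z + y * w) + (- (x * w) + - (y * z)) ≈⟨ +-cong (+-congˡ (sym -y*-w≈y*w))
                                                          (+-cong (-‿distribʳ-* x w) (-‿distribˡ-* y z)) ⟩
      (x * z + - y * - w) + (x * - w + - y * z) ≈⟨ solve-semiring 4 (λ x y z w →
                                                      (x :* z :+ y :* w) :+ (x :* w :+ y :* z) := (x :+ y) :* (z :+ w))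
                                                      refl x (- y) z (- w) ⟩
      (x - y) * (z - w)                         ∎
      where
      -y*-w≈y*w : - y * - w ≈ y * w
      -y*-w≈y*w = trans (sym (-‿distribˡ-* y (- w))) (trans (-‿cong (sym (-‿distribʳ-* y w))) (-‿involutive (y * w)))

    cancel-sound : ∀ a b → ⟦ cancel a b ⟧ ≈ ι a - ι b
    cancel-sound zero    b       = ⟦⟧-difference zero b
    cancel-sound (suc a) zero    = ⟦⟧-difference (suc a) zero
    cancel-sound (suc a) (suc b) = begin
      ⟦ cancel a b ⟧          ≈⟨ cancel-sound a b ⟩
      ι a - ι b               ≈⟨ +-identityˡ _ ⟨
      0# + (ι a - ι b)        ≈⟨ +-congʳ (-‿inverseʳ 1#) ⟨
      (1# - 1#) + (ι a - ι b) ≈⟨ sub-+ 1# 1# (ι a) (ι b) ⟨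
      (1# + ι a) - (1# + ι b) ≈⟨ +-cong (1+× a 1#) (-‿cong (1+× b 1#)) ⟨
      ι (suc a) - ι (suc b)   ∎

    ι-+-* : ∀ a c b d → ι (a ℕ.* c ℕ.+ b ℕ.* d) ≈ ι a * ι c + ι b * ι d
    ι-+-* a c b d = trans (×-homo-+ 1# (a ℕ.* c) (b ℕ.* d)) (+-cong (×1-homo-* a c) (×1-homo-* b d))

    homomorphism : Differences -Raw-AlmostCommutative⟶ fromCommutativeRing R
    homomorphism = record
      { ⟦_⟧    = ⟦_⟧
      ; +-homo = λ { (a , b) (c , d) → begin
          ⟦ cancel (a ℕ.+ c) (b ℕ.+ d) ⟧ ≈⟨ cancel-sound (a ℕ.+ c) (b ℕ.+ d) ⟩
          ι (a ℕ.+ c) - ι (b ℕ.+ d)      ≈⟨ +-cong (×-homo-+ 1# a c) (-‿cong (×-homo-+ 1# b d)) ⟩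
          (ι a + ι c) - (ι b + ι d)      ≈⟨ sub-+ (ι a) (ι b) (ι c) (ι d) ⟩
          (ι a - ι b) + (ι c - ι d)      ≈⟨ +-cong (⟦⟧-difference a b) (⟦⟧-difference c d) ⟨
          ⟦ a , b ⟧ + ⟦ c , d ⟧          ∎ }
      ; *-homo = λ { (a , b) (c , d) → begin
          ⟦ cancel (a ℕ.* c ℕ.+ b ℕ.* d) (a ℕ.* d ℕ.+ b ℕ.* c) ⟧
            ≈⟨ cancel-sound (a ℕ.* c ℕ.+ b ℕ.* d) (a ℕ.* d ℕ.+ b ℕ.* c) ⟩
          ι (a ℕ.* c ℕ.+ b ℕ.* d) - ι (a ℕ.* d ℕ.+ b ℕ.* c) ≈⟨ +-cong (ι-+-* a c b d) (-‿cong (ι-+-* a d b c)) ⟩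
          (ι a * ι c + ι b * ι d) - (ι a * ι d + ι b * ι c) ≈⟨ sub-* (ι a) (ι b) (ι c) (ι d) ⟩
          (ι a - ι b) * (ι c - ι d)                         ≈⟨ *-cong (⟦⟧-difference a b) (⟦⟧-difference c d) ⟨
          ⟦ a , b ⟧ * ⟦ c , d ⟧                             ∎ }
      ; -‿homo = λ { (a , b) → begin
          ⟦ b , a ⟧     ≈⟨ ⟦⟧-difference b a ⟩
          ι b - ι a     ≈⟨ ⁻¹-anti-homo‿- (ι a) (ι b) ⟨
          - (ι a - ι b) ≈⟨ -‿cong (⟦⟧-difference a b) ⟨
          - ⟦ a , b ⟧   ∎ }
      ; 0-homo = refl
      ; 1-homo = refl
      }

    same-pair? : ∀ x y → Maybe (⟦ x ⟧ ≈ ⟦ y ⟧)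
    same-pair? x y with ≡-dec ℕ._≟_ ℕ._≟_ x y
    ... | yes ≡.refl = just refl
    ... | no _       = nothing

  open Algebra.Solver.Ring Differences (fromCommutativeRing R) homomorphism same-pair? public

  :0 :1 : ∀ {n} → Polynomial n
  :0 = con (0 , 0)
  :1 = con (1 , 0)

module Counting where
  open import Data.Nat using (_+_; _*_; _∸_; _^_; _/_)

  triangular : ℕ → ℕ
  triangular zero    = 0
  triangular (suc n) = suc n + triangular n

  q-integer : ℕ → ℕ → ℕ
  q-integer q zero    = 0
  q-integer q (suc n) = q ^ n + q-integer q n

  triangular-double : ∀ n → n * n + n ≡ triangular n * 2
  triangular-double zero    = ≡.refl
  triangular-double (suc n) = begin
    suc n * suc n + suc n        ≡⟨ solve 1 (λ n → (con 1 :+ n) :* (con 1 :+ n) :+ (con 1 :+ n)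
                                                  := (con 1 :+ n) :* con 2 :+ (n :* n :+ n)) ≡.refl n ⟩
    suc n * 2 + (n * n + n)      ≡⟨ cong (suc n * 2 +_) (triangular-double n) ⟩
    suc n * 2 + triangular n * 2 ≡⟨ *-distribʳ-+ 2 (suc n) (triangular n) ⟨
    triangular (suc n) * 2       ∎
    where open ≡-Reasoning
          open +-*-Solver

  half-pred-double : ∀ n → (n * n + n ∸ 2) / 2 ≡ triangular n ∸ 1
  half-pred-double n = begin
    (n * n + n ∸ 2) / 2               ≡⟨ cong (λ m → (m ∸ 2) / 2) (triangular-double n) ⟩
    (triangular n * 2 ∸ 1 * 2) / 2    ≡⟨ cong (_/ 2) (*-distribʳ-∸ 2 (triangular n) 1) ⟨
    (triangular n ∸ 1) * 2 / 2        ≡⟨ m*n/n≡m (triangular n ∸ 1) 2 ⟩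
    triangular n ∸ 1                  ∎
    where open ≡-Reasoning

  q-integer-geometric : ∀ p n → q-integer (suc p) n * p + 1 ≡ suc p ^ n
  q-integer-geometric p zero    = ≡.refl
  q-integer-geometric p (suc n) = begin
    (q ^ n + q-integer q n) * p + 1   ≡⟨ solve 3 (λ a c p → (a :+ c) :* p :+ con 1 := a :* p :+ (c :* p :+ con 1))
                                            ≡.refl (q ^ n) (q-integer q n) p ⟩
    q ^ n * p + (q-integer q n * p + 1) ≡⟨ cong (q ^ n * p +_) (q-integer-geometric p n) ⟩
    q ^ n * p + q ^ n                 ≡⟨ solve 2 (λ a p → a :* p :+ a := (con 1 :+ p) :* a) ≡.refl (q ^ n) p ⟩
    q ^ suc n                         ∎
    where open ≡-Reasoning
          open +-*-Solver
          q = suc p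

  q-integer-*-pred : ∀ q n → q-integer q n * (q ∸ 1) ≡ q ^ n ∸ 1
  q-integer-*-pred zero    zero    = ≡.refl
  q-integer-*-pred zero    (suc n) = *-zeroʳ (q-integer 0 (suc n))
  q-integer-*-pred (suc p) n       =
    ≡.trans (≡.sym (m+n∸n≡m _ 1)) (cong (_∸ 1) (q-integer-geometric p n))

  ^-+-suc : ∀ q a t → q ^ (a + suc t) ≡ q * (q ^ a * q ^ t)
  ^-+-suc q a t = ≡.trans (cong (q ^_) (+-suc a t)) (cong (q *_) (^-distribˡ-+-* q a t))

open Counting

module Enumeration where
  open import Data.Nat using (_+_; _*_; _^_)

  module _ {A B : Set} {a b : ℕ} where

    ↔-× : Fin a ↔ A → Fin b ↔ B → Fin (a * b) ↔ (A × B)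
    ↔-× eA eB = ↔-trans Fin.*↔× (eA ×-↔ eB)

    ↔-⊎ : Fin a ↔ A → Fin b ↔ B → Fin (a + b) ↔ (A ⊎ B)
    ↔-⊎ eA eB = ↔-trans Fin.+↔⊎ (eA ⊎-↔ eB)

  ↔-Σ : ∀ {A : Set} {B : A → Set} {a b} (eA : Fin a ↔ A) →
        (∀ x → Fin b ↔ B x) → Fin (a * b) ↔ Σ A B
  ↔-Σ eA eB = ↔-trans Fin.*↔× (Σ-↔ eA (λ {i} → eB (Inverse.to eA i)))

  ↔-Vec : ∀ {A : Set} {a} → Fin a ↔ A → ∀ n → Fin (a ^ n) ↔ Vec A n
  ↔-Vec eA zero    = ↔-trans Fin.1↔⊤ (mk↔ₛ′ (λ _ → []) (λ _ → tt) (λ { [] → ≡.refl }) (λ _ → ≡.refl))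
  ↔-Vec eA (suc n) = ↔-trans (↔-× eA (↔-Vec eA n))
                             (mk↔ₛ′ (uncurry _∷_) uncons (λ { (x ∷ xs) → ≡.refl }) (λ _ → ≡.refl))

  any?-↔ : ∀ {A : Set} {N} → Fin N ↔ A → (P : A → Set) → (∀ x → Dec (P x)) → Dec (∃ P)
  any?-↔ e P P? = Dec.map (mk⇔ (λ (i , p) → to i , p) (λ (x , p) → from x , subst P (≡.sym (strictlyInverseˡ x)) p))
                          (Fin.any? (P? ∘ to))
    where open Inverse e

  ↔-cast : ∀ {A : Set} {a b} → a ≡ b → Fin a ↔ A → Fin b ↔ A
  ↔-cast {A} a≡b = subst (λ N → Fin N ↔ A) a≡b

open Enumeration

false≢true : false ≢ true
false≢true ()

dec-true⁻¹ : ∀ {P : Set} (p? : Dec P) → does p? ≡ true → P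
dec-true⁻¹ (yes p) _ = p

lookup-ext : ∀ {A : Set} {n} {v w : Vec A n} → (∀ i → lookup v i ≡ lookup w i) → v ≡ w
lookup-ext {v = v} {w} v≗w = ≡.trans (≡.sym (tabulate∘lookup v)) (≡.trans (tabulate-cong v≗w) (tabulate∘lookup w))

module _ (F : FiniteField) where
  open FiniteField F using (Carrier; isCommutativeRing; inverse; 0≢1; size; enum)

  commutativeRing : CommutativeRing 0ℓ 0ℓ
  commutativeRing = record { isCommutativeRing = isCommutativeRing }

  open CommutativeRing commutativeRing
    using (_+_; _*_; -_; _-_; 0#; 1#; *-comm; *-identityˡ; *-identityʳ; zeroˡ; zeroʳ; -‿inverseʳ; ring)
  open Algebra.Properties.Ring ring using (x∙y⁻¹≈ε⇒x≈y; x≈y⇒x∙y⁻¹≈ε)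
  open CommutativeRingSolver commutativeRing using (solve; _:+_; _:*_; _:-_; _:=_; :0; :1)

  _≟_ : DecidableEquality Carrier
  _≟_ = via-injection (↔⇒↣ (↔-sym enum)) Fin._≟_

  1≢0 : 1# ≢ 0#
  1≢0 = 0≢1 ∘ ≡.sym

  x-y≡0⇒x≡y : ∀ {x y} → x - y ≡ 0# → x ≡ y
  x-y≡0⇒x≡y = x∙y⁻¹≈ε⇒x≈y _ _

  x*y≡0⇒x≡0⊎y≡0 : ∀ x y → x * y ≡ 0# → x ≡ 0# ⊎ y ≡ 0#
  x*y≡0⇒x≡0⊎y≡0 x y xy≡0 with x ≟ 0#
  ... | yes x≡0 = inj₁ x≡0
  ... | no  x≢0 with inverse x x≢0
  ...   | x⁻¹ , xx⁻¹≡1 = inj₂ (begin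
    y              ≡⟨ *-identityˡ y ⟨
    1# * y         ≡⟨ cong (_* y) xx⁻¹≡1 ⟨
    x * x⁻¹ * y    ≡⟨ solve 3 (λ x x⁻¹ y → x :* x⁻¹ :* y := x⁻¹ :* (x :* y)) ≡.refl x x⁻¹ y ⟩
    x⁻¹ * (x * y)  ≡⟨ cong (x⁻¹ *_) xy≡0 ⟩
    x⁻¹ * 0#       ≡⟨ zeroʳ x⁻¹ ⟩
    0#             ∎)
    where open ≡-Reasoning

  x≢0⇒x*y≡0⇒y≡0 : ∀ {x y} → x ≢ 0# → x * y ≡ 0# → y ≡ 0#
  x≢0⇒x*y≡0⇒y≡0 x≢0 xy≡0 = [ ⊥-elim ∘ x≢0 , id ]′ (x*y≡0⇒x≡0⊎y≡0 _ _ xy≡0)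

  x*x≡0⇒x≡0 : ∀ {x} → x * x ≡ 0# → x ≡ 0#
  x*x≡0⇒x≡0 xx≡0 = reduce (x*y≡0⇒x≡0⊎y≡0 _ _ xx≡0)

  x≢0∧y≢0⇒x*y≢0 : ∀ {x y} → x ≢ 0# → y ≢ 0# → x * y ≢ 0#
  x≢0∧y≢0⇒x*y≢0 x≢0 y≢0 xy≡0 = y≢0 (x≢0⇒x*y≡0⇒y≡0 x≢0 xy≡0)

  Matrix : ℕ → Set
  Matrix n = Fin n → Fin n → Carrier

  IsSymmetric : ∀ {n} → Matrix n → Set
  IsSymmetric D = ∀ i j → D i j ≡ D j i

  Rank≤1 : ∀ {n} → Matrix n → Set
  Rank≤1 = RankAtMost F 1

  RankAtMost-cong : ∀ {n r} {D D′ : Matrix n} → (∀ i j → D i j ≡ D′ i j) → RankAtMost F r D → RankAtMost F r D′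
  RankAtMost-cong D≡D′ (U , V , D≡UV) = U , V , λ i j → ≡.trans (≡.sym (D≡D′ i j)) (D≡UV i j)

  rank≤1⇒minor : ∀ {n} {D : Matrix n} → Rank≤1 D → ∀ i j k l → D i j * D k l ≡ D i l * D k j
  rank≤1⇒minor {D = D} (U , V , D≡UV) i j k l = begin
    D i j * D k l
      ≡⟨ cong₂ _*_ (D≡UV i j) (D≡UV k l) ⟩
    (U i zero * V zero j + 0#) * (U k zero * V zero l + 0#)
      ≡⟨ solve 4 (λ a b c d → (a :* c :+ :0) :* (b :* d :+ :0) := (a :* d :+ :0) :* (b :* c :+ :0))
           ≡.refl (U i zero) (U k zero) (V zero j) (V zero l) ⟩
    (U i zero * V zero l + 0#) * (U k zero * V zero j + 0#)
      ≡⟨ cong₂ _*_ (D≡UV i l) (D≡UV k j) ⟨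
    D i l * D k j ∎
    where open ≡-Reasoning

  rank≤1-square : ∀ {n} c (x : Fin n → Carrier) → Rank≤1 (λ i j → c * (x i * x j))
  rank≤1-square c x = (λ i _ → c * x i) , (λ _ j → x j) , λ i j →
    solve 3 (λ c a b → c :* (a :* b) := c :* a :* b :+ :0) ≡.refl c (x i) (x j)

  square-adjacent : ∀ {n} (A A′ : Mat F n) {c} {x : Fin n → Carrier} {k} → x k ≡ 1# → c ≢ 0# →
                    (∀ i j → _-ᴹ_ F A A′ i j ≡ c * (x i * x j)) → Adjacent F A A′
  square-adjacent A A′ {c} {x} {k} xk≡1 c≢0 A-A′≡cxx =
    RankAtMost-cong (λ i j → ≡.sym (A-A′≡cxx i j)) (rank≤1-square c x) , rank≢0
    where
    rank≢0 : ∀ s → s ℕ.< 1 → ¬ RankAtMost F s (_-ᴹ_ F A A′)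
    rank≢0 zero    _          (_ , _ , A-A′≡0) = c≢0 (begin
      c                   ≡⟨ solve 1 (λ c → c := c :* (:1 :* :1)) ≡.refl c ⟩
      c * (1# * 1#)       ≡⟨ cong (λ z → c * (z * z)) xk≡1 ⟨
      c * (x k * x k)     ≡⟨ A-A′≡cxx k k ⟨
      _-ᴹ_ F A A′ k k     ≡⟨ A-A′≡0 k k ⟩
      0#                  ∎)
      where open ≡-Reasoning
    rank≢0 (suc s) (s≤s ())

  -- With Q i j = x k² D i j + x i x j D k k − x k x j D i k − x i x k D k j, the (i j | k k) minors of D and
  -- of E differ by c · Q i j, so Q vanishes.  Together with the minor (i i | k k) of D, Q i i = 0 forces
  -- (x k D i k − x i D k k)² = 0, and with this relation Q i j = 0 becomes the claim.
  rank≤1-pencil : ∀ {n} {D E : Matrix n} {c} (x : Fin n → Carrier) → IsSymmetric D → c ≢ 0# →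
                  Rank≤1 D → Rank≤1 E → (∀ i j → E i j ≡ D i j - c * (x i * x j)) →
                  ∀ k i j → x k * x k * D i j ≡ D k k * (x i * x j)
  rank≤1-pencil {D = D} {E} {c} x D-sym c≢0 D≤1 E≤1 E≡D-cxx k i j = x-y≡0⇒x≡y (begin
    x k * x k * D i j - D k k * (x i * x j)
      ≡⟨ solve 7 (λ Dij Dik Dkj Dkk xi xj xk →
           xk :* xk :* Dij :- Dkk :* (xi :* xj)
           := (xk :* xk :* Dij :+ xi :* xj :* Dkk :- xk :* xj :* Dik :- xi :* xk :* Dkj)
              :+ xj :* (xk :* Dik :- xi :* Dkk) :+ xi :* (xk :* Dkj :- xj :* Dkk))
           ≡.refl (D i j) (D i k) (D k j) (D k k) (x i) (x j) (x k) ⟩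
    Q i j + x j * (x k * D i k - x i * D k k) + x i * (x k * D k j - x j * D k k)
      ≡⟨ cong₂ (λ u v → u + x j * v + x i * (x k * D k j - x j * D k k))
               (Q≡0 i j) (x≈y⇒x∙y⁻¹≈ε (pivot-column i)) ⟩
    0# + x j * 0# + x i * (x k * D k j - x j * D k k)
      ≡⟨ cong (λ v → 0# + x j * 0# + x i * v)
              (x≈y⇒x∙y⁻¹≈ε (≡.trans (cong (x k *_) (D-sym k j)) (pivot-column j))) ⟩
    0# + x j * 0# + x i * 0#
      ≡⟨ solve 2 (λ a b → :0 :+ a :* :0 :+ b :* :0 := :0) ≡.refl (x j) (x i) ⟩
    0# ∎)
    where
    open ≡-Reasoning

    Q : Fin _ → Fin _ → Carrier
    Q i j = x k * x k * D i j + x i * x j * D k k - x k * x j * D i k - x i * x k * D k j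

    Q≡0 : ∀ i j → Q i j ≡ 0#
    Q≡0 i j = x≢0⇒x*y≡0⇒y≡0 c≢0 (begin
      c * Q i j
        ≡⟨ solve 8 (λ Dij Dik Dkj Dkk xi xj xk c →
             c :* (xk :* xk :* Dij :+ xi :* xj :* Dkk :- xk :* xj :* Dik :- xi :* xk :* Dkj)
             := (Dij :* Dkk :- Dik :* Dkj)
                :- ((Dij :- c :* (xi :* xj)) :* (Dkk :- c :* (xk :* xk))
                    :- (Dik :- c :* (xi :* xk)) :* (Dkj :- c :* (xk :* xj))))
             ≡.refl (D i j) (D i k) (D k j) (D k k) (x i) (x j) (x k) c ⟩
      (D i j * D k k - D i k * D k j)
        - ((D i j - c * (x i * x j)) * (D k k - c * (x k * x k))
           - (D i k - c * (x i * x k)) * (D k j - c * (x k * x j)))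
        ≡⟨ cong₂ _-_ (x≈y⇒x∙y⁻¹≈ε (rank≤1⇒minor D≤1 i j k k))
                     (≡.sym (cong₂ _-_ (cong₂ _*_ (E≡D-cxx i j) (E≡D-cxx k k))
                                       (cong₂ _*_ (E≡D-cxx i k) (E≡D-cxx k j)))) ⟩
      0# - (E i j * E k k - E i k * E k j)
        ≡⟨ cong (λ z → 0# - z) (x≈y⇒x∙y⁻¹≈ε (rank≤1⇒minor E≤1 i j k k)) ⟩
      0# - 0#
        ≡⟨ solve 0 (:0 :- :0 := :0) ≡.refl ⟩
      0# ∎)

    pivot-column : ∀ i → x k * D i k ≡ x i * D k k
    pivot-column i = x-y≡0⇒x≡y (x*x≡0⇒x≡0 (begin
      (x k * D i k - x i * D k k) * (x k * D i k - x i * D k k)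
        ≡⟨ solve 5 (λ Dii Dik Dkk xi xk →
             (xk :* Dik :- xi :* Dkk) :* (xk :* Dik :- xi :* Dkk)
             := xk :* xk :* (Dik :* Dik :- Dii :* Dkk)
                :+ Dkk :* (xk :* xk :* Dii :+ xi :* xi :* Dkk :- xk :* xi :* Dik :- xi :* xk :* Dik))
             ≡.refl (D i i) (D i k) (D k k) (x i) (x k) ⟩
      x k * x k * (D i k * D i k - D i i * D k k)
        + D k k * (x k * x k * D i i + x i * x i * D k k - x k * x i * D i k - x i * x k * D i k)
        ≡⟨ cong₂ (λ u v → x k * x k * u + D k k * v)
                 (x≈y⇒x∙y⁻¹≈ε (≡.trans (cong (D i k *_) (D-sym i k)) (≡.sym (rank≤1⇒minor D≤1 i i k k))))
                 (≡.trans (cong (λ z → x k * x k * D i i + x i * x i * D k k - x k * x i * D i k - x i * x k * z)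
                                (D-sym i k))
                          (Q≡0 i i)) ⟩
      x k * x k * 0# + D k k * 0#
        ≡⟨ solve 2 (λ a b → a :* :0 :+ b :* :0 := :0) ≡.refl (x k * x k) (D k k) ⟩
      0# ∎))

  rank≤1-pencil-at : ∀ {n} {D E : Matrix n} {c} (x : Fin n → Carrier) {k} → IsSymmetric D → c ≢ 0# →
                     Rank≤1 D → Rank≤1 E → (∀ i j → E i j ≡ D i j - c * (x i * x j)) → x k ≡ 1# →
                     ∀ i j → D i j ≡ D k k * (x i * x j)
  rank≤1-pencil-at {D = D} x {k} D-sym c≢0 D≤1 E≤1 E≡D-cxx xk≡1 i j = begin
    D i j               ≡⟨ solve 1 (λ d → d := :1 :* :1 :* d) ≡.refl (D i j) ⟩
    1# * 1# * D i j     ≡⟨ cong (λ z → z * z * D i j) xk≡1 ⟨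
    x k * x k * D i j   ≡⟨ rank≤1-pencil x D-sym c≢0 D≤1 E≤1 E≡D-cxx k i j ⟩
    D k k * (x i * x j) ∎
    where open ≡-Reasoning

  toMat : ∀ {n} → Matrix n → Mat F n
  toMat D = tabulate (λ i → tabulate (D i))

  entry-toMat : ∀ {n} (D : Matrix n) i j → entry F (toMat D) i j ≡ D i j
  entry-toMat D i j = ≡.trans (cong (λ row → lookup row j) (lookup∘tabulate _ i)) (lookup∘tabulate (D i) j)

  entry-ext : ∀ {n} {A A′ : Mat F n} → (∀ i j → entry F A i j ≡ entry F A′ i j) → A ≡ A′
  entry-ext A≗A′ = lookup-ext (λ i → lookup-ext (A≗A′ i))

  _≟ᴹ_ : ∀ {n} → DecidableEquality (Mat F n)
  _≟ᴹ_ = Vec.≡-dec (Vec.≡-dec _≟_)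

  maximal-⊆⇒≐ : ∀ {n} {M N : Subset F n} → MaximalRank1 F M → MaximalRank1 F N →
                (∀ A → M A ≡ true → N A ≡ true) → _≐_ F M N
  maximal-⊆⇒≐ {M = M} {N} (_ , _ , M-maximal) (N-symmetric , N-adjacent , _) M⊆N A with M A in MA
  ... | true  = ≡.sym (M⊆N A MA)
  ... | false with N A in NA
  ...   | false = ≡.refl
  ...   | true  = ⊥-elim (M-maximal A (N-symmetric A NA) MA λ A′ MA′ →
                    N-adjacent A A′ NA (M⊆N A′ MA′) λ A≡A′ →
                      false≢true (≡.trans (≡.sym MA) (≡.trans (cong M A≡A′) MA′)))

  record Line (n : ℕ) : Set where
    field
      base            : Matrix n
      direction       : Fin n → Carrier
      pivot           : Fin n
      base-symmetric  : IsSymmetric base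
      direction-pivot : direction pivot ≡ 1#
      base-pivot      : base pivot pivot ≡ 0#

    -- The points of the line are base + t · direction directionᵀ (t ∈ F).  Thanks to the normalisation
    -- at the pivot, t is the pivot entry of the point, which makes membership decidable.
    OnLine : Mat F n → Set
    OnLine A = ∀ i j → entry F A i j ≡ base i j + entry F A pivot pivot * (direction i * direction j)

    onLine? : ∀ A → Dec (OnLine A)
    onLine? A = Fin.all? λ i → Fin.all? λ j →
      entry F A i j ≟ (base i j + entry F A pivot pivot * (direction i * direction j))

    points : Subset F n
    points A = does (onLine? A)

    point : Carrier → Mat F n
    point t = toMat (λ i j → base i j + t * (direction i * direction j))

  module _ {n} (ℓ : Line n) where
    open Line ℓ renaming (base to B; direction to x; pivot to k)

    points⇒onLine : ∀ A → points A ≡ true → OnLine A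
    points⇒onLine A = dec-true⁻¹ (onLine? A)

    point-pivot : ∀ t → entry F (point t) k k ≡ t
    point-pivot t = begin
      entry F (point t) k k    ≡⟨ entry-toMat _ k k ⟩
      B k k + t * (x k * x k)  ≡⟨ cong₂ (λ b y → b + t * (y * y)) base-pivot direction-pivot ⟩
      0# + t * (1# * 1#)       ≡⟨ solve 1 (λ t → :0 :+ t :* (:1 :* :1) := t) ≡.refl t ⟩
      t                        ∎
      where open ≡-Reasoning

    point∈points : ∀ t → points (point t) ≡ true
    point∈points t = dec-true (onLine? (point t)) λ i j →
      ≡.trans (entry-toMat _ i j) (cong (λ s → B i j + s * (x i * x j)) (≡.sym (point-pivot t)))

    onLine⇒symmetric : ∀ A → OnLine A → Symmetric F A
    onLine⇒symmetric A A-onLine i j = begin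
      entry F A i j                        ≡⟨ A-onLine i j ⟩
      B i j + entry F A k k * (x i * x j)  ≡⟨ cong₂ (λ b y → b + entry F A k k * y)
                                                      (base-symmetric i j) (*-comm (x i) (x j)) ⟩
      B j i + entry F A k k * (x j * x i)  ≡⟨ A-onLine j i ⟨
      entry F A j i                        ∎
      where open ≡-Reasoning

    onLine⇒adjacent : ∀ A A′ → OnLine A → OnLine A′ → A ≢ A′ → Adjacent F A A′
    onLine⇒adjacent A A′ A-onLine A′-onLine A≢A′ = square-adjacent A A′ direction-pivot a-a′≢0 A-A′≡
      where
      a = entry F A k k
      a′ = entry F A′ k k

      A-A′≡ : ∀ i j → _-ᴹ_ F A A′ i j ≡ (a - a′) * (x i * x j)
      A-A′≡ i j = ≡.trans (cong₂ _-_ (A-onLine i j) (A′-onLine i j))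
        (solve 4 (λ b a a′ y → (b :+ a :* y) :- (b :+ a′ :* y) := (a :- a′) :* y) ≡.refl (B i j) a a′ (x i * x j))

      a-a′≢0 : a - a′ ≢ 0#
      a-a′≢0 a-a′≡0 = A≢A′ (entry-ext λ i j → ≡.trans (A-onLine i j)
        (≡.trans (cong (λ s → B i j + s * (x i * x j)) (x-y≡0⇒x≡y a-a′≡0)) (≡.sym (A′-onLine i j))))

    adjacent⇒onLine : ∀ C → Symmetric F C → Adjacent F C (point 0#) → Adjacent F C (point 1#) → OnLine C
    adjacent⇒onLine C C-symmetric (C-B≤1 , _) (C-B-xx≤1 , _) i j = begin
      entry F C i j
        ≡⟨ solve 3 (λ c b y → c := (c :- (b :+ :0 :* y)) :+ (b :+ :0 :* y)) ≡.refl (entry F C i j) (B i j) (X i j) ⟩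
      D i j + (B i j + 0# * X i j)
        ≡⟨ cong (_+ (B i j + 0# * X i j)) (rank≤1-pencil-at x D-symmetric 1≢0 D≤1 C-B-xx≤1 E≡D-X direction-pivot i j) ⟩
      D k k * X i j + (B i j + 0# * X i j)
        ≡⟨ cong (λ d → d * X i j + (B i j + 0# * X i j)) Dkk≡Ckk ⟩
      entry F C k k * X i j + (B i j + 0# * X i j)
        ≡⟨ solve 3 (λ c b y → c :* y :+ (b :+ :0 :* y) := b :+ c :* y) ≡.refl (entry F C k k) (B i j) (X i j) ⟩
      B i j + entry F C k k * X i j ∎
      where
      open ≡-Reasoning

      X D : Matrix n
      X i j = x i * x j
      D i j = entry F C i j - (B i j + 0# * X i j)

      D≤1 : Rank≤1 D
      D≤1 = RankAtMost-cong (λ i j → cong (λ p → entry F C i j - p) (entry-toMat _ i j)) C-B≤1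

      D-symmetric : IsSymmetric D
      D-symmetric i j = cong₂ (λ c (b , y) → c - (b + 0# * y)) (C-symmetric i j)
                              (cong₂ _,_ (base-symmetric i j) (*-comm (x i) (x j)))

      E≡D-X : ∀ i j → _-ᴹ_ F C (point 1#) i j ≡ D i j - 1# * X i j
      E≡D-X i j = ≡.trans (cong (λ p → entry F C i j - p) (entry-toMat _ i j))
        (solve 3 (λ c b y → c :- (b :+ :1 :* y) := (c :- (b :+ :0 :* y)) :- :1 :* y) ≡.refl (entry F C i j) (B i j) (X i j))

      Dkk≡Ckk : D k k ≡ entry F C k k
      Dkk≡Ckk = ≡.trans (cong (λ b → entry F C k k - (b + 0# * X k k)) base-pivot)
                        (solve 2 (λ c y → c :- (:0 :+ :0 :* y) := c) ≡.refl (entry F C k k) (X k k))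

    points-maximal : MaximalRank1 F points
    points-maximal =
        (λ A A∈ℓ → onLine⇒symmetric A (points⇒onLine A A∈ℓ))
      , (λ A A′ A∈ℓ A′∈ℓ → onLine⇒adjacent A A′ (points⇒onLine A A∈ℓ) (points⇒onLine A′ A′∈ℓ))
      , λ C C-symmetric C∉ℓ C-adjacent →
          false≢true (≡.trans (≡.sym C∉ℓ) (dec-true (onLine? C) (adjacent⇒onLine C C-symmetric
            (C-adjacent (point 0#) (point∈points 0#)) (C-adjacent (point 1#) (point∈points 1#)))))

  NumberOf-↔ : ∀ {n N} {C : Set} {P : Subset F n → Set} (e : Fin N ↔ C) (s : C → Subset F n) →
               (∀ c → P (s c)) → (∀ c c′ → _≐_ F (s c) (s c′) → c ≡ c′) → (∀ M → P M → ∃[ c ] _≐_ F M (s c)) →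
               NumberOf F P N
  NumberOf-↔ e s P-s s-injective s-surjective =
      s ∘ to
    , P-s ∘ to
    , (λ i j si≐sj → ≡.trans (≡.sym (strictlyInverseʳ i))
                               (≡.trans (cong from (s-injective _ _ si≐sj)) (strictlyInverseʳ j)))
    , λ M P-M → let (c , M≐sc) = s-surjective M P-M in
        from c , λ A → ≡.trans (M≐sc A) (cong (λ c → s c A) (≡.sym (strictlyInverseˡ c)))
    where open Inverse e

  clique⇒rank≤1 : ∀ {n} {M : Subset F n} → (∀ A A′ → M A ≡ true → M A′ ≡ true → A ≢ A′ → Adjacent F A A′) →
                  ∀ A A′ → M A ≡ true → M A′ ≡ true → Rank≤1 (_-ᴹ_ F A A′)
  clique⇒rank≤1 M-adjacent A A′ A∈M A′∈M with A ≟ᴹ A′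
  ... | no A≢A′    = proj₁ (M-adjacent A A′ A∈M A′∈M A≢A′)
  ... | yes ≡.refl = RankAtMost-cong (λ i j → ≡.trans (zeroˡ _) (≡.sym (-‿inverseʳ (entry F A i j))))
                                     (rank≤1-square 0# (λ _ → 0#))

  -- `Sym n` lists the free entries of a symmetric matrix (corner, rest of the first row, lower-right
  -- block), `SymZeroAt k` those of a symmetric matrix with zero (k, k) entry, and `Normalised n` the
  -- nonzero vectors whose first nonzero entry is 1.
  Sym : ℕ → Set
  Sym zero    = ⊤
  Sym (suc n) = Carrier × Vec Carrier n × Sym n

  SymZeroAt : ∀ {n} → Fin n → Set
  SymZeroAt {suc n} zero    = Vec Carrier n × Sym n
  SymZeroAt {suc n} (suc k) = Carrier × Vec Carrier n × SymZeroAt k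

  Normalised : ℕ → Set
  Normalised zero    = ⊥
  Normalised (suc n) = Vec Carrier n ⊎ Normalised n

  border : ∀ {n} → Carrier → Vec Carrier n → Matrix n → Matrix (suc n)
  border a r D zero    zero    = a
  border a r D zero    (suc j) = lookup r j
  border a r D (suc i) zero    = lookup r i
  border a r D (suc i) (suc j) = D i j

  border-symmetric : ∀ {n} a r {D : Matrix n} → IsSymmetric D → IsSymmetric (border a r D)
  border-symmetric a r D-symmetric zero    zero    = ≡.refl
  border-symmetric a r D-symmetric zero    (suc j) = ≡.refl
  border-symmetric a r D-symmetric (suc i) zero    = ≡.refl
  border-symmetric a r D-symmetric (suc i) (suc j) = D-symmetric i j

  border-injective : ∀ {n a a′ r r′} {D D′ : Matrix n} → (∀ i j → border a r D i j ≡ border a′ r′ D′ i j) →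
                     a ≡ a′ × r ≡ r′ × (∀ i j → D i j ≡ D′ i j)
  border-injective eq = eq zero zero , lookup-ext (eq zero ∘ suc) , λ i j → eq (suc i) (suc j)

  first-row : ∀ {n} → Matrix (suc n) → Vec Carrier n
  first-row E = tabulate (E zero ∘ suc)

  lower-block : ∀ {n} → Matrix (suc n) → Matrix n
  lower-block E i j = E (suc i) (suc j)

  border-split : ∀ {n a} {E : Matrix (suc n)} {D : Matrix n} → IsSymmetric E → a ≡ E zero zero →
                 (∀ i j → D i j ≡ lower-block E i j) → ∀ i j → border a (first-row E) D i j ≡ E i j
  border-split E-symmetric a≡E₀₀ D≡E zero    zero    = a≡E₀₀
  border-split E-symmetric a≡E₀₀ D≡E zero    (suc j) = lookup∘tabulate _ j
  border-split E-symmetric a≡E₀₀ D≡E (suc i) zero    = ≡.trans (lookup∘tabulate _ i) (E-symmetric zero (suc i))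
  border-split E-symmetric a≡E₀₀ D≡E (suc i) (suc j) = D≡E i j

  symMatrix : ∀ {n} → Sym n → Matrix n
  symMatrix {suc n} (a , r , s) = border a r (symMatrix s)

  symMatrix-symmetric : ∀ {n} (s : Sym n) → IsSymmetric (symMatrix s)
  symMatrix-symmetric {suc n} (a , r , s) = border-symmetric a r (symMatrix-symmetric s)

  symMatrix-injective : ∀ {n} (s s′ : Sym n) → (∀ i j → symMatrix s i j ≡ symMatrix s′ i j) → s ≡ s′
  symMatrix-injective {zero}  tt          tt             _  = ≡.refl
  symMatrix-injective {suc n} (a , r , s) (a′ , r′ , s′) eq =
    let (a≡a′ , r≡r′ , s≗s′) = border-injective eq in
    cong₂ _,_ a≡a′ (cong₂ _,_ r≡r′ (symMatrix-injective s s′ s≗s′))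

  readSym : ∀ {n} → Matrix n → Sym n
  readSym {zero}  E = tt
  readSym {suc n} E = E zero zero , first-row E , readSym (lower-block E)

  symMatrix-readSym : ∀ {n} {E : Matrix n} → IsSymmetric E → ∀ i j → symMatrix (readSym E) i j ≡ E i j
  symMatrix-readSym {suc n} E-symmetric =
    border-split E-symmetric ≡.refl (symMatrix-readSym (λ i j → E-symmetric (suc i) (suc j)))

  zeroAtMatrix : ∀ {n} {k : Fin n} → SymZeroAt k → Matrix n
  zeroAtMatrix {suc n} {zero}  (r , s)     = border 0# r (symMatrix s)
  zeroAtMatrix {suc n} {suc k} (a , r , z) = border a r (zeroAtMatrix z)

  zeroAtMatrix-symmetric : ∀ {n} {k : Fin n} (z : SymZeroAt k) → IsSymmetric (zeroAtMatrix z)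
  zeroAtMatrix-symmetric {suc n} {zero}  (r , s)     = border-symmetric 0# r (symMatrix-symmetric s)
  zeroAtMatrix-symmetric {suc n} {suc k} (a , r , z) = border-symmetric a r (zeroAtMatrix-symmetric z)

  zeroAtMatrix-pivot : ∀ {n} {k : Fin n} (z : SymZeroAt k) → zeroAtMatrix z k k ≡ 0#
  zeroAtMatrix-pivot {suc n} {zero}  (r , s)     = ≡.refl
  zeroAtMatrix-pivot {suc n} {suc k} (a , r , z) = zeroAtMatrix-pivot z

  zeroAtMatrix-injective : ∀ {n} {k : Fin n} (z z′ : SymZeroAt k) →
                           (∀ i j → zeroAtMatrix z i j ≡ zeroAtMatrix z′ i j) → z ≡ z′
  zeroAtMatrix-injective {suc n} {zero} (r , s) (r′ , s′) eq =
    let (_ , r≡r′ , s≗s′) = border-injective eq in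
    cong₂ _,_ r≡r′ (symMatrix-injective s s′ s≗s′)
  zeroAtMatrix-injective {suc n} {suc k} (a , r , z) (a′ , r′ , z′) eq =
    let (a≡a′ , r≡r′ , z≗z′) = border-injective eq in
    cong₂ _,_ a≡a′ (cong₂ _,_ r≡r′ (zeroAtMatrix-injective z z′ z≗z′))

  readZeroAt : ∀ {n} (k : Fin n) → Matrix n → SymZeroAt k
  readZeroAt zero    E = first-row E , readSym (lower-block E)
  readZeroAt (suc k) E = E zero zero , first-row E , readZeroAt k (lower-block E)

  zeroAtMatrix-readZeroAt : ∀ {n} (k : Fin n) {E : Matrix n} → IsSymmetric E → E k k ≡ 0# →
                            ∀ i j → zeroAtMatrix (readZeroAt k E) i j ≡ E i j
  zeroAtMatrix-readZeroAt zero    E-symmetric Ekk≡0 =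
    border-split E-symmetric (≡.sym Ekk≡0) (symMatrix-readSym (λ i j → E-symmetric (suc i) (suc j)))
  zeroAtMatrix-readZeroAt (suc k) E-symmetric Ekk≡0 =
    border-split E-symmetric ≡.refl (zeroAtMatrix-readZeroAt k (λ i j → E-symmetric (suc i) (suc j)) Ekk≡0)

  vector : ∀ {n} → Normalised n → Fin n → Carrier
  vector {suc n} (inj₁ v) zero    = 1#
  vector {suc n} (inj₁ v) (suc i) = lookup v i
  vector {suc n} (inj₂ x) zero    = 0#
  vector {suc n} (inj₂ x) (suc i) = vector x i

  pivotOf : ∀ {n} → Normalised n → Fin n
  pivotOf {suc n} (inj₁ _) = zero
  pivotOf {suc n} (inj₂ x) = suc (pivotOf x)

  vector-pivot : ∀ {n} (x : Normalised n) → vector x (pivotOf x) ≡ 1#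
  vector-pivot {suc n} (inj₁ _) = ≡.refl
  vector-pivot {suc n} (inj₂ x) = vector-pivot x

  normalised-proportional⇒≡ : ∀ {n} (x y : Normalised n) {d} → (∀ i → vector x i ≡ d * vector y i) → x ≡ y
  normalised-proportional⇒≡ {suc n} (inj₁ v) (inj₁ w) {d} x≡dy = cong inj₁ (lookup-ext λ i →
    ≡.trans (x≡dy (suc i)) (≡.trans (cong (_* lookup w i) d≡1) (*-identityˡ (lookup w i))))
    where
    d≡1 : d ≡ 1#
    d≡1 = ≡.sym (≡.trans (x≡dy zero) (*-identityʳ d))
  normalised-proportional⇒≡ {suc n} (inj₁ v) (inj₂ y) x≡dy = ⊥-elim (1≢0 (≡.trans (x≡dy zero) (zeroʳ _)))
  normalised-proportional⇒≡ {suc n} (inj₂ x) (inj₁ w) {d} x≡dy = ⊥-elim (1≢0 (≡.trans (≡.sym (vector-pivot x))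
    (≡.trans (x≡dy (suc (pivotOf x))) (≡.trans (cong (_* _) d≡0) (zeroˡ _)))))
    where
    d≡0 : d ≡ 0#
    d≡0 = ≡.sym (≡.trans (x≡dy zero) (*-identityʳ d))
  normalised-proportional⇒≡ {suc n} (inj₂ x) (inj₂ y) x≡dy =
    cong inj₂ (normalised-proportional⇒≡ x y (x≡dy ∘ suc))

  normalise : ∀ {n} (y : Fin n → Carrier) {m} → y m ≢ 0# →
              Σ[ x ∈ Normalised n ] Σ[ s ∈ Carrier ] s ≢ 0# × (∀ i → y i ≡ s * vector x i)
  normalise {suc n} y {m} ym≢0 with y zero ≟ 0#
  normalise {suc n} y {m} ym≢0 | no y₀≢0 =
    inj₁ (tabulate λ j → y (suc j) * w) , y zero , y₀≢0 , λ
      { zero    → ≡.sym (*-identityʳ (y zero))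
      ; (suc i) → ≡.sym (begin
          y zero * lookup (tabulate λ j → y (suc j) * w) i ≡⟨ cong (y zero *_) (lookup∘tabulate _ i) ⟩
          y zero * (y (suc i) * w)                          ≡⟨ solve 3 (λ a b w → a :* (b :* w) := (a :* w) :* b)
                                                                 ≡.refl (y zero) (y (suc i)) w ⟩
          y zero * w * y (suc i)                            ≡⟨ cong (_* y (suc i)) y₀w≡1 ⟩
          1# * y (suc i)                                    ≡⟨ *-identityˡ (y (suc i)) ⟩
          y (suc i)                                         ∎) }
    where
    open ≡-Reasoning
    w = proj₁ (inverse (y zero) y₀≢0)
    y₀w≡1 = proj₂ (inverse (y zero) y₀≢0)
  normalise {suc n} y {zero}  y₀≢0 | yes y₀≡0 = ⊥-elim (y₀≢0 y₀≡0)
  normalise {suc n} y {suc m} ym≢0 | yes y₀≡0 =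
    let (x , s , s≢0 , y≡sx) = normalise (y ∘ suc) ym≢0 in
    inj₂ x , s , s≢0 , λ { zero → ≡.trans y₀≡0 (≡.sym (zeroʳ s)) ; (suc i) → y≡sx i }

  zero-diagonal⇒zero : ∀ {n} {D : Matrix n} → IsSymmetric D → Rank≤1 D → (∀ m → D m m ≡ 0#) → ∀ i j → D i j ≡ 0#
  zero-diagonal⇒zero {D = D} D-symmetric D≤1 diagonal≡0 i j = x*x≡0⇒x≡0 (begin
    D i j * D i j  ≡⟨ cong (D i j *_) (D-symmetric i j) ⟩
    D i j * D j i  ≡⟨ rank≤1⇒minor D≤1 i j j i ⟩
    D i i * D j j  ≡⟨ cong (_* D j j) (diagonal≡0 i) ⟩
    0# * D j j     ≡⟨ zeroˡ (D j j) ⟩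
    0#             ∎)
    where open ≡-Reasoning

  symmetric-rank1⇒square : ∀ {n} {D : Matrix n} → IsSymmetric D → Rank F D 1 →
                           Σ[ x ∈ Normalised n ] Σ[ c ∈ Carrier ] c ≢ 0# × (∀ i j → D i j ≡ c * (vector x i * vector x j))
  symmetric-rank1⇒square {D = D} D-symmetric (D≤1 , rank≢0) with Fin.any? (λ m → ¬? (D m m ≟ 0#))
  ... | no diagonal≡0 = ⊥-elim (rank≢0 0 (s≤s z≤n) ((λ _ ()) , (λ ()) , zero-diagonal⇒zero D-symmetric D≤1 λ m →
          Dec.decidable-stable (D m m ≟ 0#) (λ Dmm≢0 → diagonal≡0 (m , Dmm≢0))))
  ... | yes (m , Dmm≢0) =
    let w , Dmm*w≡1 = inverse (D m m) Dmm≢0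
        x , s , s≢0 , Dw≡sx = normalise (λ i → D i m * w) {m} λ Dmm*w≡0 → 1≢0 (≡.trans (≡.sym Dmm*w≡1) Dmm*w≡0)
    in x , D m m * (s * s) , x≢0∧y≢0⇒x*y≢0 Dmm≢0 (x≢0∧y≢0⇒x*y≢0 s≢0 s≢0) , λ i j → begin
      D i j                                 ≡⟨ solve 1 (λ d → d := d :* :1 :* :1) ≡.refl (D i j) ⟩
      D i j * 1# * 1#                       ≡⟨ cong (λ u → D i j * u * u) Dmm*w≡1 ⟨
      D i j * (D m m * w) * (D m m * w)     ≡⟨ solve 4 (λ a d w u → a :* (d :* w) :* u := (a :* d) :* w :* u)
                                                 ≡.refl (D i j) (D m m) w (D m m * w) ⟩
      D i j * D m m * w * (D m m * w)       ≡⟨ cong (λ u → u * w * (D m m * w))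
                                                    (≡.trans (rank≤1⇒minor D≤1 i j m m) (cong (D i m *_) (D-symmetric m j))) ⟩
      D i m * D j m * w * (D m m * w)       ≡⟨ solve 4 (λ a b d w → a :* b :* w :* (d :* w) := d :* (a :* w) :* (b :* w))
                                                 ≡.refl (D i m) (D j m) (D m m) w ⟩
      D m m * (D i m * w) * (D j m * w)     ≡⟨ cong₂ (λ u v → D m m * u * v) (Dw≡sx i) (Dw≡sx j) ⟩
      D m m * (s * vector x i) * (s * vector x j)
        ≡⟨ solve 4 (λ d s a b → d :* (s :* a) :* (s :* b) := d :* (s :* s) :* (a :* b))
             ≡.refl (D m m) s (vector x i) (vector x j) ⟩
      D m m * (s * s) * (vector x i * vector x j) ∎
    where open ≡-Reasoning

  -- The base of a line only matters up to multiples of x xᵀ, so it can be normalised to vanish at the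
  -- pivot of x.
  Code : ℕ → Set
  Code n = Σ (Normalised n) (SymZeroAt ∘ pivotOf)

  codeLine : ∀ {n} → Code n → Line n
  codeLine (x , z) = record
    { base            = zeroAtMatrix z
    ; direction       = vector x
    ; pivot           = pivotOf x
    ; base-symmetric  = zeroAtMatrix-symmetric z
    ; direction-pivot = vector-pivot x
    ; base-pivot      = zeroAtMatrix-pivot z
    }

  module _ {n} (ℓ ℓ′ : Line n) (same-points : _≐_ F (Line.points ℓ) (Line.points ℓ′)) where
    open Line ℓ  using (point) renaming (base to B; direction to x; pivot to k)
    open Line ℓ′ using () renaming (base to B′; direction to x′; pivot to k′)

    point-onLine′ : ∀ t → Line.OnLine ℓ′ (point t)
    point-onLine′ t = points⇒onLine ℓ′ (point t) (≡.trans (≡.sym (same-points (point t))) (point∈points ℓ t))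

    same-points⇒proportional : ∃[ d ] ∀ i → x i ≡ d * x′ i
    same-points⇒proportional = (l₁ - l₀) * x′ k , λ i → begin
      x i                                ≡⟨ solve 1 (λ a → a := a :* :1) ≡.refl (x i) ⟩
      x i * 1#                           ≡⟨ cong (x i *_) (Line.direction-pivot ℓ) ⟨
      x i * x k                          ≡⟨ xx≡ i k ⟩
      (l₁ - l₀) * (x′ i * x′ k)          ≡⟨ solve 3 (λ l a b → l :* (a :* b) := l :* b :* a) ≡.refl (l₁ - l₀) (x′ i) (x′ k) ⟩
      (l₁ - l₀) * x′ k * x′ i            ∎
      where
      open ≡-Reasoning
      l₀ = entry F (point 0#) k′ k′
      l₁ = entry F (point 1#) k′ k′

      xx≡ : ∀ i j → x i * x j ≡ (l₁ - l₀) * (x′ i * x′ j)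
      xx≡ i j = begin
        x i * x j
          ≡⟨ solve 2 (λ b y → y := (b :+ :1 :* y) :- (b :+ :0 :* y)) ≡.refl (B i j) (x i * x j) ⟩
        (B i j + 1# * (x i * x j)) - (B i j + 0# * (x i * x j))
          ≡⟨ cong₂ _-_ (≡.trans (≡.sym (entry-toMat _ i j)) (point-onLine′ 1# i j))
                       (≡.trans (≡.sym (entry-toMat _ i j)) (point-onLine′ 0# i j)) ⟩
        (B′ i j + l₁ * (x′ i * x′ j)) - (B′ i j + l₀ * (x′ i * x′ j))
          ≡⟨ solve 4 (λ b l₁ l₀ y → (b :+ l₁ :* y) :- (b :+ l₀ :* y) := (l₁ :- l₀) :* y) ≡.refl (B′ i j) l₁ l₀ (x′ i * x′ j) ⟩
        (l₁ - l₀) * (x′ i * x′ j) ∎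

    same-points⇒same-base : k ≡ k′ → ∀ i j → B i j ≡ B′ i j
    same-points⇒same-base k≡k′ i j = begin
      B i j                                             ≡⟨ solve 2 (λ b y → b := b :+ :0 :* y) ≡.refl (B i j) (x i * x j) ⟩
      B i j + 0# * (x i * x j)                          ≡⟨ entry-toMat _ i j ⟨
      entry F (point 0#) i j                            ≡⟨ point-onLine′ 0# i j ⟩
      B′ i j + entry F (point 0#) k′ k′ * (x′ i * x′ j) ≡⟨ cong (λ t → B′ i j + t * (x′ i * x′ j)) l₀≡0 ⟩
      B′ i j + 0# * (x′ i * x′ j)                       ≡⟨ solve 2 (λ b y → b :+ :0 :* y := b) ≡.refl (B′ i j) (x′ i * x′ j) ⟩
      B′ i j                                            ∎
      where
      open ≡-Reasoning
      l₀≡0 : entry F (point 0#) k′ k′ ≡ 0#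
      l₀≡0 = ≡.trans (cong (λ k → entry F (point 0#) k k) (≡.sym k≡k′)) (point-pivot ℓ 0#)

  Code-≡ : ∀ {n} {x x′ : Normalised n} {z : SymZeroAt (pivotOf x)} {z′ : SymZeroAt (pivotOf x′)} → x ≡ x′ →
           (∀ i j → zeroAtMatrix z i j ≡ zeroAtMatrix z′ i j) → (x , z) ≡ (x′ , z′)
  Code-≡ ≡.refl z≗z′ = cong (_ ,_) (zeroAtMatrix-injective _ _ z≗z′)

  codeLine-injective : ∀ {n} (c c′ : Code n) → _≐_ F (Line.points (codeLine c)) (Line.points (codeLine c′)) → c ≡ c′
  codeLine-injective c@(x , _) c′@(x′ , _) same-points =
    Code-≡ x≡x′ (same-points⇒same-base (codeLine c) (codeLine c′) same-points (cong pivotOf x≡x′))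
    where
    x≡x′ : x ≡ x′
    x≡x′ = normalised-proportional⇒≡ x x′ (proj₂ (same-points⇒proportional (codeLine c) (codeLine c′) same-points))

  ↔-Mat : ∀ n → Fin ((size ℕ.^ n) ℕ.^ n) ↔ Mat F n
  ↔-Mat n = ↔-Vec (↔-Vec enum n) n

  maximal⇒member : ∀ {n} {M : Subset F n} → MaximalRank1 F M → ∃[ S ] M S ≡ true
  maximal⇒member {n} {M} (_ , _ , M-maximal) with any?-↔ (↔-Mat n) (λ A → M A ≡ true) (λ A → M A Bool.≟ true)
  ... | yes S∈M = S∈M
  ... | no  M≡∅ = ⊥-elim (M-maximal O O-symmetric (¬-not λ O∈M → M≡∅ (O , O∈M))
                                   λ A A∈M → ⊥-elim (M≡∅ (A , A∈M)))
    where
    O = toMat (λ _ _ → 0#)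
    O-symmetric : Symmetric F O
    O-symmetric i j = ≡.trans (entry-toMat _ i j) (≡.sym (entry-toMat _ j i))

  maximal⇒second-member : ∀ {m} {M : Subset F (suc m)} → MaximalRank1 F M →
                          ∀ {S} → M S ≡ true → ∃[ T ] (M T ≡ true × T ≢ S)
  maximal⇒second-member {m} {M} (M-symmetric , _ , M-maximal) {S} S∈M
    with any?-↔ (↔-Mat (suc m)) (λ A → M A ≡ true × A ≢ S) (λ A → (M A Bool.≟ true) ×-dec ¬? (A ≟ᴹ S))
  ... | yes T = T
  ... | no ∄T = ⊥-elim (M-maximal C C-symmetric (¬-not λ C∈M → C≢S (only-S C C∈M)) C-adjacent)
    where
    e₀ : Fin (suc m) → Carrier
    e₀ zero    = 1#
    e₀ (suc _) = 0#

    S+e₀e₀ᵀ : Matrix (suc m)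
    S+e₀e₀ᵀ i j = entry F S i j + 1# * (e₀ i * e₀ j)

    C = toMat S+e₀e₀ᵀ

    C-S≡ : ∀ i j → _-ᴹ_ F C S i j ≡ 1# * (e₀ i * e₀ j)
    C-S≡ i j = ≡.trans (cong (_- entry F S i j) (entry-toMat S+e₀e₀ᵀ i j))
      (solve 2 (λ s y → (s :+ :1 :* y) :- s := :1 :* y) ≡.refl (entry F S i j) (e₀ i * e₀ j))

    C-symmetric : Symmetric F C
    C-symmetric i j = ≡.trans (entry-toMat S+e₀e₀ᵀ i j)
      (≡.trans (cong₂ (λ s y → s + 1# * y) (M-symmetric S S∈M i j) (*-comm (e₀ i) (e₀ j)))
               (≡.sym (entry-toMat S+e₀e₀ᵀ j i)))

    C≢S : C ≢ S
    C≢S C≡S = 1≢0 (begin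
      1#                     ≡⟨ solve 0 (:1 := :1 :* (:1 :* :1)) ≡.refl ⟩
      1# * (1# * 1#)         ≡⟨ C-S≡ zero zero ⟨
      _-ᴹ_ F C S zero zero   ≡⟨ cong (λ A → _-ᴹ_ F A S zero zero) C≡S ⟩
      _-ᴹ_ F S S zero zero   ≡⟨ -‿inverseʳ (entry F S zero zero) ⟩
      0#                     ∎)
      where open ≡-Reasoning

    only-S : ∀ A → M A ≡ true → A ≡ S
    only-S A A∈M = Dec.decidable-stable (A ≟ᴹ S) λ A≢S → ∄T (A , A∈M , A≢S)

    C-adjacent : ∀ A → M A ≡ true → Adjacent F C A
    C-adjacent A A∈M with only-S A A∈M
    ... | ≡.refl = square-adjacent C S {k = zero} ≡.refl 1≢0 C-S≡

  maximal⇒collinear : ∀ {n} {M : Subset F n} → MaximalRank1 F M → ∀ {S T} → M S ≡ true → M T ≡ true →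
                      ∀ (x : Fin n → Carrier) {k c} → x k ≡ 1# → c ≢ 0# →
                      (∀ i j → _-ᴹ_ F T S i j ≡ c * (x i * x j)) →
                      ∀ A → M A ≡ true → ∀ i j → _-ᴹ_ F A S i j ≡ _-ᴹ_ F A S k k * (x i * x j)
  maximal⇒collinear (M-symmetric , M-adjacent , _) {S} {T} S∈M T∈M x {c = c} xk≡1 c≢0 T-S≡ A A∈M =
    rank≤1-pencil-at x A-S-symmetric c≢0
      (clique⇒rank≤1 M-adjacent A S A∈M S∈M) (clique⇒rank≤1 M-adjacent A T A∈M T∈M) A-T≡ xk≡1
    where
    A-S-symmetric : IsSymmetric (_-ᴹ_ F A S)
    A-S-symmetric i j = cong₂ _-_ (M-symmetric A A∈M i j) (M-symmetric S S∈M i j)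

    A-T≡ : ∀ i j → _-ᴹ_ F A T i j ≡ _-ᴹ_ F A S i j - c * (x i * x j)
    A-T≡ i j = ≡.trans
      (solve 3 (λ a t s → a :- t := (a :- s) :- (t :- s)) ≡.refl (entry F A i j) (entry F T i j) (entry F S i j))
      (cong (λ d → _-ᴹ_ F A S i j - d) (T-S≡ i j))

  maximal⇒line : ∀ {m} {M : Subset F (suc m)} → MaximalRank1 F M → ∃[ c ] _≐_ F M (Line.points (codeLine c))
  maximal⇒line {m} {M} M-maximal@(M-symmetric , M-adjacent , _) with maximal⇒member M-maximal
  ... | S , S∈M with maximal⇒second-member M-maximal S∈M
  ...   | T , T∈M , T≢S with symmetric-rank1⇒square T-S-symmetric (M-adjacent T S T∈M S∈M T≢S)
    where
    T-S-symmetric : IsSymmetric (_-ᴹ_ F T S)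
    T-S-symmetric i j = cong₂ _-_ (M-symmetric T T∈M i j) (M-symmetric S S∈M i j)
  ...     | x , c , c≢0 , T-S≡ = code , maximal-⊆⇒≐ M-maximal (points-maximal (codeLine code)) M⊆line
    where
    open ≡-Reasoning
    k = pivotOf x

    X : Matrix (suc m)
    X i j = vector x i * vector x j

    B : Matrix (suc m)
    B i j = entry F S i j - entry F S k k * X i j

    B-symmetric : IsSymmetric B
    B-symmetric i j = cong₂ (λ s y → s - entry F S k k * y) (M-symmetric S S∈M i j) (*-comm (vector x i) (vector x j))

    B-pivot : B k k ≡ 0#
    B-pivot = ≡.trans (cong (λ y → entry F S k k - entry F S k k * (y * y)) (vector-pivot x))
                      (solve 1 (λ s → s :- s :* (:1 :* :1) := :0) ≡.refl (entry F S k k))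

    code : Code (suc m)
    code = x , readZeroAt k B

    M⊆line : ∀ A → M A ≡ true → Line.points (codeLine code) A ≡ true
    M⊆line A A∈M = dec-true (Line.onLine? (codeLine code) A) λ i j → begin
      entry F A i j
        ≡⟨ solve 2 (λ a s → a := (a :- s) :+ s) ≡.refl (entry F A i j) (entry F S i j) ⟩
      _-ᴹ_ F A S i j + entry F S i j
        ≡⟨ cong (_+ entry F S i j) (maximal⇒collinear M-maximal S∈M T∈M (vector x) (vector-pivot x) c≢0 T-S≡ A A∈M i j) ⟩
      (entry F A k k - entry F S k k) * X i j + entry F S i j
        ≡⟨ solve 4 (λ a s y sij → (a :- s) :* y :+ sij := (sij :- s :* y) :+ a :* y)
             ≡.refl (entry F A k k) (entry F S k k) (X i j) (entry F S i j) ⟩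
      B i j + entry F A k k * X i j
        ≡⟨ cong (_+ entry F A k k * X i j) (zeroAtMatrix-readZeroAt k B-symmetric B-pivot i j) ⟨
      zeroAtMatrix (readZeroAt k B) i j + entry F A k k * X i j ∎

  ↔-Sym : ∀ n → Fin (size ℕ.^ triangular n) ↔ Sym n
  ↔-Sym zero    = Fin.1↔⊤
  ↔-Sym (suc n) = ↔-cast (cong (size ℕ.*_) (≡.sym (^-distribˡ-+-* size n (triangular n))))
                         (↔-× enum (↔-× (↔-Vec enum n) (↔-Sym n)))

  ↔-SymZeroAt : ∀ {n} (k : Fin n) → Fin (size ℕ.^ (triangular n ℕ.∸ 1)) ↔ SymZeroAt k
  ↔-SymZeroAt {suc n}       zero    = ↔-cast (≡.sym (^-distribˡ-+-* size n (triangular n)))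
                                             (↔-× (↔-Vec enum n) (↔-Sym n))
  ↔-SymZeroAt {suc (suc n)} (suc k) = ↔-cast (≡.sym (^-+-suc size (suc n) (n ℕ.+ triangular n)))
                                             (↔-× enum (↔-× (↔-Vec enum (suc n)) (↔-SymZeroAt k)))

  ↔-Normalised : ∀ n → Fin (q-integer size n) ↔ Normalised n
  ↔-Normalised zero    = Fin.0↔⊥
  ↔-Normalised (suc n) = ↔-⊎ (↔-Vec enum n) (↔-Normalised n)

  ↔-Code : ∀ n → Fin (q-integer size n ℕ.* size ℕ.^ (triangular n ℕ.∸ 1)) ↔ Code n
  ↔-Code n = ↔-Σ (↔-Normalised n) (↔-SymZeroAt ∘ pivotOf)

  maximal-sets-count : ∀ m → NumberOf F (MaximalRank1 F {suc m})
                                        (q-integer size (suc m) ℕ.* size ℕ.^ (triangular (suc m) ℕ.∸ 1))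
  maximal-sets-count m = NumberOf-↔ (↔-Code (suc m)) (Line.points ∘ codeLine)
    (points-maximal ∘ codeLine) codeLine-injective (λ M → maximal⇒line)

open import Data.Nat using (_*_; _+_; _∸_; _^_; _/_; _≥_)

lemma5 : (F : FiniteField) → (n : ℕ) → n ≥ 1 →
    let q = FiniteField.size F in
    Σ[ N ∈ ℕ ] (NumberOf F (MaximalRank1 F {n}) N
      × N * (q ∸ 1) ≡ (q ^ n ∸ 1) * q ^ ((n * n + n ∸ 2) / 2))
lemma5 F n@(suc m) _ = q-integer q n * q ^ e , maximal-sets-count F m , count
  where
  open ≡-Reasoning
  open +-*-Solver
  q = FiniteField.size F
  e = triangular n ∸ 1

  count : q-integer q n * q ^ e * (q ∸ 1) ≡ (q ^ n ∸ 1) * q ^ ((n * n + n ∸ 2) / 2)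
  count = begin
    q-integer q n * q ^ e * (q ∸ 1)          ≡⟨ solve 3 (λ a b c → a :* b :* c := a :* c :* b) ≡.refl
                                                  (q-integer q n) (q ^ e) (q ∸ 1) ⟩
    q-integer q n * (q ∸ 1) * q ^ e          ≡⟨ cong (_* q ^ e) (q-integer-*-pred q n) ⟩
    (q ^ n ∸ 1) * q ^ e                      ≡⟨ cong (λ e → (q ^ n ∸ 1) * q ^ e) (half-pred-double n) ⟨
    (q ^ n ∸ 1) * q ^ ((n * n + n ∸ 2) / 2)  ∎
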